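{- Let $\mathcal{D}$ be a reliable digraph property, $D$ a digraph, and $(X,H)$ a $\mathcal{D}$-critical cover of $D$. Then: (a) for every $v\in V(D)$, $d_D(v)\ge d(\mathcal{D})\cdot|X_v|$; (b) if $v\in V(D)$ satisfies $d^+_D(v)=d^+(\mathcal{D})|X_v|$ and $T$ is a partial transversal of $(X,H)$ with $\mathrm{dom}(T:D)=V(D)\setminus\{v\}$ and $H[T]\in\mathcal{D}$, and for $x\in X_v$ we set $H_x=H[T\cup\{x\}]$ and $d^+_x=d^+_{H_x}(x)$, then $d^+_x=d^+(\mathcal{D})$ for all $x\in X_v$ and $d^+_D(v)=\sum_{x\in X_v}d^+_x$; (c) if $v\in V(D)$ satisfies $d^-_D(v)=d^-(\mathcal{D})|X_v|$ and $T$ is a partial transversal of $(X,H)$ with $\mathrm{dom}(T:D)=V(D)\setminus\{v\}$ and $H[T]\in\mathcal{D}$, and for $x\in X_v$ we set $H_x=H[T\cup\{x\}]$ and $d^-_x=d^-_{H_x}(x)$, then $d^-_x=d^-(\mathcal{D})$ for all $x\in X_v$ and $d^-_D(v)=\sum_{x\in X_v}d^-_x$.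
   Context: Digraphs are finite, without loops and parallel arcs (digons allowed); $d_D(v)=(d^+_D(v),d^-_D(v))$; pairs compared coordinatewise and multiplied by integers coordinatewise. A digraph property is a class of digraphs closed under isomorphism; reliable: nontrivial (contains a nonempty digraph but not all), hereditary (closed under induced subdigraphs), additive (closed under disjoint unions). $\mathrm{CR}(\mathcal{D})$: digraphs $D\notin\mathcal{D}$ with $D-v\in\mathcal{D}$ for all $v$; $d(\mathcal{D})=(d^+(\mathcal{D}),d^-(\mathcal{D}))$, $d^\pm(\mathcal{D})=\min\{\delta^\pm(D):D\in\mathrm{CR}(\mathcal{D})\}$. Cover of $D$: pair $(X,H)$, $H$ disjoint from $D$, $X_v\subseteq V(H)$ pairwise disjoint with union $V(H)$, each independent, arcs from $X_u$ to $X_v$ ($u\ne v$) a matching if $uv\in A(D)$, none otherwise. Transversal: $|T\cap X_v|=1$ for all $v$; partial transversal: $|T\cap X_v|\le1$; $\mathrm{dom}(T:D)=\{v:X_v\cap T\ne\varnothing\}$. $(X,H)$ is $\mathcal{D}$-critical if it has no transversal $T$ with $H[T]\in\mathcal{D}$, but for every $v$ there is a partial transversal $T$ with $\mathrm{dom}(T:D)=V(D)\setminus\{v\}$ and $H[T]\in\mathcal{D}$. -}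

module Defs where

open import Data.Nat using (ℕ; zero; suc; _+_; _*_; _≤_)
open import Data.Bool using (Bool; true; false; if_then_else_)
open import Data.Fin using (Fin; zero; suc; splitAt; punchIn)
open import Data.Fin.Subset using (Subset; _∈_; _∩_; _∪_; ∣_∣; ⁅_⁆; Nonempty; ∁)
open import Data.Vec using (Vec; lookup; tabulate; []; _∷_)
open import Data.Sum using (_⊎_; inj₁; inj₂)
open import Data.Product using (Σ; ∃; ∃-syntax; _×_; _,_)
open import Relation.Binary.PropositionalEquality using (_≡_; _≢_; refl)
open import Relation.Nullary using (¬_)
open import Function.Bundles using (_⇔_)
open import Function.Definitions using (Injective; Surjective)

-- Digraphs: vertex set Fin n, arc relation given by a Boolean matrix,
-- no loops (arc v v ≡ false). No parallel arcs is automatic; digons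
-- (arc u v ≡ arc v u ≡ true) are allowed.

record Digraph (n : ℕ) : Set where
  field
    arc      : Fin n → Fin n → Bool
    loopless : ∀ v → arc v v ≡ false
open Digraph public

outNbrs : ∀ {n} → Digraph n → Fin n → Subset n
outNbrs D v = tabulate (λ w → arc D v w)

inNbrs : ∀ {n} → Digraph n → Fin n → Subset n
inNbrs D v = tabulate (λ w → arc D w v)

outdeg : ∀ {n} → Digraph n → Fin n → ℕ
outdeg D v = ∣ outNbrs D v ∣

indeg : ∀ {n} → Digraph n → Fin n → ℕ
indeg D v = ∣ inNbrs D v ∣

-- out/in-degree of x in the induced subdigraph H[S] (x ∈ S):
-- number of out/in-neighbours of x lying in S
outdegIn : ∀ {m} → Digraph m → Subset m → Fin m → ℕ
outdegIn H S x = ∣ S ∩ outNbrs H x ∣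

indegIn : ∀ {m} → Digraph m → Subset m → Fin m → ℕ
indegIn H S x = ∣ S ∩ inNbrs H x ∣

sumOver : ∀ {m} → Subset m → (Fin m → ℕ) → ℕ
sumOver {zero}  []      f = 0
sumOver {suc m} (b ∷ S) f =
  (if b then f zero else 0) + sumOver S (λ x → f (suc x))

record Embedding {m n : ℕ} (D' : Digraph m) (D : Digraph n) : Set where
  field
    map       : Fin m → Fin n
    injective : Injective _≡_ _≡_ map
    preserves : ∀ a b → arc D' a b ≡ arc D (map a) (map b)
open Embedding public

ImageIs : ∀ {m n} {D' : Digraph m} {D : Digraph n} →
          Embedding D' D → Subset n → Set
ImageIs e S = ∀ y → (y ∈ S) ⇔ (∃[ a ] map e a ≡ y)

Iso : ∀ {m n} → Digraph m → Digraph n → Set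
Iso D D' = Σ (Embedding D D') (λ e → Surjective _≡_ _≡_ (map e))

⊕-arc : ∀ {n n'} → Digraph n → Digraph n' →
        Fin n ⊎ Fin n' → Fin n ⊎ Fin n' → Bool
⊕-arc D D' (inj₁ a) (inj₁ b) = arc D a b
⊕-arc D D' (inj₂ a) (inj₂ b) = arc D' a b
⊕-arc D D' (inj₁ a) (inj₂ b) = false
⊕-arc D D' (inj₂ a) (inj₁ b) = false

⊕-loopless : ∀ {n n'} (D : Digraph n) (D' : Digraph n') →
             ∀ p → ⊕-arc D D' p p ≡ false
⊕-loopless D D' (inj₁ a) = loopless D a
⊕-loopless D D' (inj₂ a) = loopless D' a

_⊕_ : ∀ {n n'} → Digraph n → Digraph n' → Digraph (n + n')
_⊕_ {n} D D' = record
  { arc      = λ a b → ⊕-arc D D' (splitAt n a) (splitAt n b)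
  ; loopless = λ a → ⊕-loopless D D' (splitAt n a)
  }

-- a class of digraphs (closedness under isomorphism is required below)
Property : Set₁
Property = ∀ {n} → Digraph n → Set

IsoClosed : Property → Set
IsoClosed P = ∀ {m n} (D : Digraph m) (D' : Digraph n) → Iso D D' → P D → P D'

Hereditary : Property → Set
Hereditary P = ∀ {m n} (D' : Digraph m) (D : Digraph n) →
               Embedding D' D → P D → P D'

Additive : Property → Set
Additive P = ∀ {n n'} (D : Digraph n) (D' : Digraph n') →
             P D → P D' → P (D ⊕ D')

Nontrivial : Property → Set
Nontrivial P = (∃[ n ] Σ (Digraph (suc n)) P)
             × (∃[ n ] Σ (Digraph n) (λ D → ¬ P D))

record Reliable (P : Property) : Set where
  field
    isoClosed  : IsoClosed P
    nontrivial : Nontrivial P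
    hereditary : Hereditary P
    additive   : Additive P

-- H[S] ∈ P : the induced subdigraph of H on S belongs to P
InducedIn : Property → ∀ {m} → Digraph m → Subset m → Set
InducedIn P {m} H S =
  ∃[ k ] Σ (Digraph k) (λ H' → Σ (Embedding H' H) (λ e → ImageIs e S × P H'))

Critical : Property → ∀ {n} → Digraph n → Set
Critical P D = ¬ P D × (∀ v → InducedIn P D (∁ ⁅ v ⁆))

-- d⁺(P) = k :  k = min { δ⁺(D) : D ∈ CR(P) }
IsDPlus : Property → ℕ → Set
IsDPlus P k =
  (∃[ n ] Σ (Digraph n) (λ D → Critical P D
        × (∃[ v ] outdeg D v ≡ k) × (∀ v → k ≤ outdeg D v)))
  × (∀ {n} (D : Digraph n) → Critical P D → ∀ v → k ≤ outdeg D v)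

-- d⁻(P) = k :  k = min { δ⁻(D) : D ∈ CR(P) }
IsDMinus : Property → ℕ → Set
IsDMinus P k =
  (∃[ n ] Σ (Digraph n) (λ D → Critical P D
        × (∃[ v ] indeg D v ≡ k) × (∀ v → k ≤ indeg D v)))
  × (∀ {n} (D : Digraph n) → Critical P D → ∀ v → k ≤ indeg D v)

record Cover {n m : ℕ} (D : Digraph n) (H : Digraph m) : Set where
  field
    X        : Fin n → Subset m
    disjoint : ∀ u v x → x ∈ X u → x ∈ X v → u ≡ v
    covers   : ∀ x → ∃[ v ] x ∈ X v
    indep    : ∀ v x y → x ∈ X v → y ∈ X v → arc H x y ≡ false
    -- uv ∈ A(D), u ≠ v: the arcs from X_u to X_v form a matching
    matchTail : ∀ u v → u ≢ v → arc D u v ≡ true → ∀ x y y' →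
                x ∈ X u → y ∈ X v → y' ∈ X v →
                arc H x y ≡ true → arc H x y' ≡ true → y ≡ y'
    matchHead : ∀ u v → u ≢ v → arc D u v ≡ true → ∀ x x' y →
                x ∈ X u → x' ∈ X u → y ∈ X v →
                arc H x y ≡ true → arc H x' y ≡ true → x ≡ x'
    noArcs   : ∀ u v → u ≢ v → arc D u v ≡ false → ∀ x y →
               x ∈ X u → y ∈ X v → arc H x y ≡ false
open Cover public

module _ {n m : ℕ} {D : Digraph n} {H : Digraph m} (C : Cover D H) where

  Transversal : Subset m → Set
  Transversal T = ∀ v → ∣ T ∩ X C v ∣ ≡ 1

  PartialTransversal : Subset m → Set
  PartialTransversal T = ∀ v → ∣ T ∩ X C v ∣ ≤ 1

  InDom : Subset m → Fin n → Set
  InDom T u = Nonempty (T ∩ X C u)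

  DomAllBut : Subset m → Fin n → Set
  DomAllBut T v = ∀ u → InDom T u ⇔ (u ≢ v)

  CriticalCover : Property → Set
  CriticalCover P =
    ¬ (∃[ T ] Transversal T × InducedIn P H T)
    × (∀ v → ∃[ T ] PartialTransversal T × DomAllBut T v × InducedIn P H T)

{-# OPTIONS --safe #-}
module Submission where

-- Fix v and a partial transversal T with dom(T) = V(D) ∖ {v} and H[T] ∈ 𝒟. For x ∈ X_v the set
-- T ∪ {x} is a transversal, so H[T ∪ {x}] ∉ 𝒟 while H[T] ∈ 𝒟; hence H[T ∪ {x}] has a critical
-- induced subdigraph through x, and x has out-degree at least d⁺(𝒟) in H[T ∪ {x}]. These
-- out-neighbourhoods lie in T, are pairwise disjoint (arcs from X_v to X_u form a matching) and
-- project injectively into N⁺_D(v) (T meets each X_u at most once), so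
-- d⁺(𝒟) |X_v| ≤ Σ_x d⁺_x ≤ d⁺_D(v), and in the equality case every d⁺_x equals d⁺(𝒟).
-- Reversing all arcs gives the in-degree statements.
-- Membership in 𝒟 is not decidable, so the critical subdigraph is only found under a double
-- negation; this suffices because the resulting degree bound is decidable.

open import Defs
open import Data.Nat using (ℕ; zero; suc; _+_; _*_; _≤_; _≤?_; z≤n; s≤s)
open import Data.Nat.Properties
  using (≤-reflexive; ≤-trans; ≤-antisym; <⇒≱; *-zeroʳ; *-suc;
         +-mono-≤; +-monoˡ-≤; +-monoʳ-≤; +-cancelˡ-≤; +-cancelʳ-≤; +-suc; module ≤-Reasoning)
open import Data.Bool using (true; false)
open import Data.Fin using (Fin; zero; suc; _≟_)
open import Data.Fin.Properties using (injective⇒≤; suc-injective; ∀-cons)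
open import Data.Fin.Subset
open import Data.Fin.Subset.Properties
open import Data.Fin.Subset.Induction using (⊂-wellFounded)
open import Data.Vec using ([]; _∷_; here; there)
open import Data.Vec.Properties using ([]=⇒lookup; lookup⇒[]=; lookup∘tabulate)
open import Data.Product using (∃-syntax; _×_; _,_; proj₁; proj₂)
open import Data.Sum using (_⊎_; inj₁; inj₂)
import Data.Sum as Sum
open import Function using (_∘_; id)
open import Function.Bundles using (mk⇔; module Equivalence)
open import Function.Definitions using (Injective)
open import Induction.WellFounded using (Acc; acc)
open import Relation.Binary.PropositionalEquality
  using (_≡_; _≢_; refl; sym; trans; cong; cong₂; subst; module ≡-Reasoning)
open import Relation.Nullary using (¬_; yes; no)
open import Relation.Nullary.Decidable using (decidable-stable)
open import Relation.Nullary.Negation using (¬¬-map; contradiction)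

¬¬-∀ : ∀ {m} {Q : Fin m → Set} → (∀ i → ¬ ¬ Q i) → ¬ ¬ (∀ i → Q i)
¬¬-∀ {zero}  _  k = k (λ ())
¬¬-∀ {suc m} ¬¬Q k = ¬¬Q zero λ Q₀ → ¬¬-∀ (¬¬Q ∘ suc) λ Qₛ → k (∀-cons Q₀ Qₛ)

¬¬-∀⊎∃¬ : ∀ {m} (Q : Fin m → Set) → ¬ ¬ ((∀ i → Q i) ⊎ ∃[ i ] ¬ Q i)
¬¬-∀⊎∃¬ Q k = ¬¬-∀ (λ i ¬Qi → k (inj₂ (i , ¬Qi))) (k ∘ inj₁)

enum : ∀ {m} (S : Subset m) → Fin ∣ S ∣ → Fin m
enum (true  ∷ S) zero    = zero
enum (true  ∷ S) (suc i) = suc (enum S i)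
enum (false ∷ S) i       = suc (enum S i)

enum-∈ : ∀ {m} (S : Subset m) i → enum S i ∈ S
enum-∈ (true  ∷ S) zero    = here
enum-∈ (true  ∷ S) (suc i) = there (enum-∈ S i)
enum-∈ (false ∷ S) i       = there (enum-∈ S i)

enum-injective : ∀ {m} (S : Subset m) → Injective _≡_ _≡_ (enum S)
enum-injective (true  ∷ S) {zero}  {zero}  _ = refl
enum-injective (true  ∷ S) {suc i} {suc j} e = cong suc (enum-injective S (suc-injective e))
enum-injective (false ∷ S)                 e = enum-injective S (suc-injective e)

enum-surjective : ∀ {m} (S : Subset m) {x} → x ∈ S → ∃[ i ] enum S i ≡ x
enum-surjective (true  ∷ S) here = zero , refl
enum-surjective (true  ∷ S) (there x∈S) with enum-surjective S x∈S
... | i , refl = suc i , refl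
enum-surjective (false ∷ S) (there x∈S) with enum-surjective S x∈S
... | i , refl = i , refl

injectiveOn⇒∣p∣≤∣q∣ : ∀ {m n} {p : Subset m} {q : Subset n} (f : Fin m → Fin n) →
                      (∀ {x} → x ∈ p → f x ∈ q) →
                      (∀ {x y} → x ∈ p → y ∈ p → f x ≡ f y → x ≡ y) → ∣ p ∣ ≤ ∣ q ∣
injectiveOn⇒∣p∣≤∣q∣ {p = p} {q} f f∈q f-injective = injective⇒≤ {f = index} index-injective
  where
  index : Fin ∣ p ∣ → Fin ∣ q ∣
  index i = proj₁ (enum-surjective q (f∈q (enum-∈ p i)))

  index-injective : Injective _≡_ _≡_ index
  index-injective {i} {j} e = enum-injective p (f-injective (enum-∈ p i) (enum-∈ p j) (begin
    f (enum p i)     ≡⟨ sym (proj₂ (enum-surjective q (f∈q (enum-∈ p i)))) ⟩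
    enum q (index i) ≡⟨ cong (enum q) e ⟩
    enum q (index j) ≡⟨ proj₂ (enum-surjective q (f∈q (enum-∈ p j))) ⟩
    f (enum p j)     ∎))
    where open ≡-Reasoning

x∈p⇒1≤∣p∣ : ∀ {m} {p : Subset m} {x} → x ∈ p → 1 ≤ ∣ p ∣
x∈p⇒1≤∣p∣ {x = x} x∈p = subst (_≤ _) (∣⁅x⁆∣≡1 x) (p⊆q⇒∣p∣≤∣q∣ ⁅x⁆⊆p)
  where
  ⁅x⁆⊆p : ⁅ x ⁆ ⊆ _
  ⁅x⁆⊆p y∈⁅x⁆ = subst (_∈ _) (sym (x∈⁅y⁆⇒x≡y x y∈⁅x⁆)) x∈p

∣p∣≡1 : ∀ {m} {p q : Subset m} {x} → x ∈ p → p ⊆ q → ∣ q ∣ ≤ 1 → ∣ p ∣ ≡ 1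
∣p∣≡1 x∈p p⊆q ∣q∣≤1 = ≤-antisym (≤-trans (p⊆q⇒∣p∣≤∣q∣ p⊆q) ∣q∣≤1) (x∈p⇒1≤∣p∣ x∈p)

x∉p-x : ∀ {m} (p : Subset m) x → x ∉ p - x
x∉p-x (_ ∷ p) zero    ()
x∉p-x (_ ∷ p) (suc x) (there x∈p-x) = x∉p-x p x x∈p-x

∣p∣≤1⇒≡ : ∀ {m} {p : Subset m} {x y} → ∣ p ∣ ≤ 1 → x ∈ p → y ∈ p → x ≡ y
∣p∣≤1⇒≡ {x = x} {y} ∣p∣≤1 x∈p y∈p = decidable-stable (x ≟ y) λ x≢y →
  <⇒≱ (x∈p⇒∣p-x∣<∣p∣ x∈p) (≤-trans ∣p∣≤1 (x∈p⇒1≤∣p∣ (x∈p∧x≢y⇒x∈p-y y∈p (x≢y ∘ sym))))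

∈-∪⁅⁆⁻ : ∀ {m} (p : Subset m) {x y} → y ∈ p ∪ ⁅ x ⁆ → y ∈ p ⊎ y ≡ x
∈-∪⁅⁆⁻ p {x} y∈ = Sum.map₂ (x∈⁅y⁆⇒x≡y x) (x∈p∪q⁻ p ⁅ x ⁆ y∈)

∣p∣+∣q∣≤∣p∪q∣ : ∀ {m} (p q : Subset m) → Empty (p ∩ q) → ∣ p ∣ + ∣ q ∣ ≤ ∣ p ∪ q ∣
∣p∣+∣q∣≤∣p∪q∣ []          []          _     = z≤n
∣p∣+∣q∣≤∣p∪q∣ (true  ∷ p) (true  ∷ q) p∩q=∅ = contradiction (zero , here) p∩q=∅
∣p∣+∣q∣≤∣p∪q∣ (true  ∷ p) (false ∷ q) p∩q=∅ = s≤s (∣p∣+∣q∣≤∣p∪q∣ p q (drop-∷-Empty p∩q=∅))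
∣p∣+∣q∣≤∣p∪q∣ (false ∷ p) (true  ∷ q) p∩q=∅ rewrite +-suc ∣ p ∣ ∣ q ∣ =
  s≤s (∣p∣+∣q∣≤∣p∪q∣ p q (drop-∷-Empty p∩q=∅))
∣p∣+∣q∣≤∣p∪q∣ (false ∷ p) (false ∷ q) p∩q=∅ = ∣p∣+∣q∣≤∣p∪q∣ p q (drop-∷-Empty p∩q=∅)

unionOver : ∀ {m m′} → Subset m → (Fin m → Subset m′) → Subset m′
unionOver []          F = ⊥
unionOver (true  ∷ S) F = F zero ∪ unionOver S (F ∘ suc)
unionOver (false ∷ S) F = unionOver S (F ∘ suc)

∈-unionOver⁻ : ∀ {m m′} (S : Subset m) (F : Fin m → Subset m′) {y} →
               y ∈ unionOver S F → ∃[ x ] x ∈ S × y ∈ F x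
∈-unionOver⁻ []          F y∈ = contradiction y∈ ∉⊥
∈-unionOver⁻ (true  ∷ S) F y∈ with x∈p∪q⁻ (F zero) _ y∈
... | inj₁ y∈F₀ = zero , here , y∈F₀
... | inj₂ y∈⋃ with ∈-unionOver⁻ S (F ∘ suc) y∈⋃
...   | x , x∈S , y∈Fx = suc x , there x∈S , y∈Fx
∈-unionOver⁻ (false ∷ S) F y∈ with ∈-unionOver⁻ S (F ∘ suc) y∈
... | x , x∈S , y∈Fx = suc x , there x∈S , y∈Fx

DisjointOn : ∀ {m m′} → Subset m → (Fin m → Subset m′) → Set
DisjointOn S F = ∀ {x x′ y} → x ∈ S → x′ ∈ S → y ∈ F x → y ∈ F x′ → x ≡ x′

DisjointOn-tail : ∀ {m m′} {b} {S : Subset m} {F : Fin (suc m) → Subset m′} →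
                  DisjointOn (b ∷ S) F → DisjointOn S (F ∘ suc)
DisjointOn-tail disjoint x∈S x′∈S y∈Fx y∈Fx′ =
  suc-injective (disjoint (there x∈S) (there x′∈S) y∈Fx y∈Fx′)

sumOver-∣∣≤∣unionOver∣ : ∀ {m m′} (S : Subset m) (F : Fin m → Subset m′) → DisjointOn S F →
                          sumOver S (λ x → ∣ F x ∣) ≤ ∣ unionOver S F ∣
sumOver-∣∣≤∣unionOver∣ []          F _        = z≤n
sumOver-∣∣≤∣unionOver∣ (true  ∷ S) F disjoint = ≤-trans
  (+-monoʳ-≤ ∣ F zero ∣ (sumOver-∣∣≤∣unionOver∣ S (F ∘ suc) (DisjointOn-tail disjoint)))
  (∣p∣+∣q∣≤∣p∪q∣ (F zero) _ F₀∩⋃=∅)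
  where
  F₀∩⋃=∅ : Empty (F zero ∩ unionOver S (F ∘ suc))
  F₀∩⋃=∅ (y , y∈∩) with x∈p∩q⁻ (F zero) _ y∈∩
  ... | y∈F₀ , y∈⋃ with ∈-unionOver⁻ S (F ∘ suc) y∈⋃
  ...   | x , x∈S , y∈Fx with () ← disjoint here (there x∈S) y∈F₀ y∈Fx
sumOver-∣∣≤∣unionOver∣ (false ∷ S) F disjoint =
  sumOver-∣∣≤∣unionOver∣ S (F ∘ suc) (DisjointOn-tail disjoint)

sumOver-const : ∀ {m} (S : Subset m) k → sumOver S (λ _ → k) ≡ k * ∣ S ∣
sumOver-const []          k = sym (*-zeroʳ k)
sumOver-const (true  ∷ S) k = trans (cong (k +_) (sumOver-const S k)) (sym (*-suc k ∣ S ∣))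
sumOver-const (false ∷ S) k = sumOver-const S k

sumOver-mono : ∀ {m} (S : Subset m) {f g : Fin m → ℕ} →
               (∀ {x} → x ∈ S → f x ≤ g x) → sumOver S f ≤ sumOver S g
sumOver-mono []          f≤g = z≤n
sumOver-mono (true  ∷ S) f≤g = +-mono-≤ (f≤g here) (sumOver-mono S (f≤g ∘ there))
sumOver-mono (false ∷ S) f≤g = sumOver-mono S (f≤g ∘ there)

sumOver-rigid : ∀ {m} (S : Subset m) {f g : Fin m → ℕ} → (∀ {x} → x ∈ S → f x ≤ g x) →
                sumOver S g ≤ sumOver S f → ∀ {x} → x ∈ S → f x ≡ g x
sumOver-rigid (true  ∷ S) {f} {g} f≤g Σg≤Σf here = ≤-antisym (f≤g here)
  (+-cancelʳ-≤ _ (g zero) (f zero)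
    (≤-trans Σg≤Σf (+-monoʳ-≤ (f zero) (sumOver-mono S (f≤g ∘ there)))))
sumOver-rigid (true  ∷ S) {f} {g} f≤g Σg≤Σf (there x∈S) = sumOver-rigid S (f≤g ∘ there)
  (+-cancelˡ-≤ (g zero) _ _ (≤-trans Σg≤Σf (+-monoˡ-≤ _ (f≤g here))))
  x∈S
sumOver-rigid (false ∷ S) f≤g Σg≤Σf (there x∈S) = sumOver-rigid S (f≤g ∘ there) Σg≤Σf x∈S

∈-outNbrs⁺ : ∀ {m} (H : Digraph m) {x y} → arc H x y ≡ true → y ∈ outNbrs H x
∈-outNbrs⁺ H {x} {y} xy = lookup⇒[]= y _ (trans (lookup∘tabulate (arc H x) y) xy)

∈-outNbrs⁻ : ∀ {m} (H : Digraph m) {x y} → y ∈ outNbrs H x → arc H x y ≡ true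
∈-outNbrs⁻ H {x} {y} y∈ = trans (sym (lookup∘tabulate (arc H x) y)) ([]=⇒lookup y∈)

∈-∪⁅⁆∩outNbrs⁻ : ∀ {m} (H : Digraph m) (S : Subset m) {x y} →
                 y ∈ (S ∪ ⁅ x ⁆) ∩ outNbrs H x → y ∈ S × arc H x y ≡ true
∈-∪⁅⁆∩outNbrs⁻ H S {x} y∈ with x∈p∩q⁻ (S ∪ ⁅ x ⁆) _ y∈
... | y∈S∪x , y∈N⁺x with ∈-∪⁅⁆⁻ S y∈S∪x | ∈-outNbrs⁻ H y∈N⁺x
...   | inj₁ y∈S  | xy = y∈S , xy
...   | inj₂ refl | xx with () ← trans (sym xx) (loopless H x)

outdegIn-mono : ∀ {m} (H : Digraph m) {S S′ : Subset m} {x} →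
                S ⊆ S′ → outdegIn H S x ≤ outdegIn H S′ x
outdegIn-mono H {S} S⊆S′ = p⊆q⇒∣p∣≤∣q∣ λ y∈ →
  let y∈S , y∈N⁺x = x∈p∩q⁻ S _ y∈ in x∈p∩q⁺ (S⊆S′ y∈S , y∈N⁺x)

_[_] : ∀ {m} → Digraph m → (S : Subset m) → Digraph ∣ S ∣
H [ S ] = record
  { arc      = λ i j → arc H (enum S i) (enum S j)
  ; loopless = λ i → loopless H (enum S i)
  }

outdeg[]≤outdegIn : ∀ {m} (H : Digraph m) (S : Subset m) i →
                    outdeg (H [ S ]) i ≤ outdegIn H S (enum S i)
outdeg[]≤outdegIn H S i = injectiveOn⇒∣p∣≤∣q∣ (enum S)
  (λ j∈ → x∈p∩q⁺ (enum-∈ S _ , ∈-outNbrs⁺ H (∈-outNbrs⁻ (H [ S ]) j∈)))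
  (λ _ _ → enum-injective S)

enumEmbedding : ∀ {m} (H : Digraph m) (S : Subset m) → Embedding (H [ S ]) H
enumEmbedding H S = record
  { map = enum S ; injective = enum-injective S ; preserves = λ _ _ → refl }

image-enumEmbedding : ∀ {m} (H : Digraph m) (S : Subset m) → ImageIs (enumEmbedding H S) S
image-enumEmbedding H S y = mk⇔ (enum-surjective S) λ { (i , refl) → enum-∈ S i }

factorEmbedding : ∀ {k₁ k₂ m} {H₁ : Digraph k₁} {H₂ : Digraph k₂} {H : Digraph m}
                  (e : Embedding H₁ H) (f : Embedding H₂ H) →
                  (∀ a → ∃[ b ] map e b ≡ map f a) → Embedding H₂ H₁
factorEmbedding {k₁} {k₂} {H₁ = H₁} {H₂} {H} e f f⊆e = record
  { map       = g
  ; injective = λ {a} {a′} ga≡ga′ →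
      injective f (trans (sym (eg a)) (trans (cong (map e) ga≡ga′) (eg a′)))
  ; preserves = λ a a′ → begin
      arc H₂ a a′                        ≡⟨ preserves f a a′ ⟩
      arc H (map f a) (map f a′)         ≡⟨ sym (cong₂ (arc H) (eg a) (eg a′)) ⟩
      arc H (map e (g a)) (map e (g a′)) ≡⟨ sym (preserves e (g a) (g a′)) ⟩
      arc H₁ (g a) (g a′)                ∎
  }
  where
  open ≡-Reasoning
  g : Fin k₂ → Fin k₁
  g a = proj₁ (f⊆e a)
  eg : ∀ a → map e (g a) ≡ map f a
  eg a = proj₂ (f⊆e a)

module _ (P : Property) (hereditary : Hereditary P) where

  P[]⇒InducedIn : ∀ {m} {H : Digraph m} {S} → P (H [ S ]) → InducedIn P H S
  P[]⇒InducedIn {H = H} {S} P[S] = _ , H [ S ] , enumEmbedding H S , image-enumEmbedding H S , P[S]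

  InducedIn-⊆ : ∀ {m} {H : Digraph m} {S S′} → S′ ⊆ S → InducedIn P H S → InducedIn P H S′
  InducedIn-⊆ {H = H} {S} {S′} S′⊆S (_ , H′ , e , image , PH′) =
    P[]⇒InducedIn (hereditary (H [ S′ ]) H′ (factorEmbedding e (enumEmbedding H S′) S′⊆image) PH′)
    where
    S′⊆image : ∀ i → ∃[ a ] map e a ≡ enum S′ i
    S′⊆image i = Equivalence.to (image (enum S′ i)) (S′⊆S (enum-∈ S′ i))

  critical[] : ∀ {m} {H : Digraph m} {S} → ¬ InducedIn P H S →
               (∀ i → InducedIn P H (S - enum S i)) → Critical P (H [ S ])
  critical[] {H = H} {S} ¬PS PS-y = ¬PS ∘ P[]⇒InducedIn , λ i → deleted i (PS-y i)
    where
    deleted : ∀ i → InducedIn P H (S - enum S i) → InducedIn P (H [ S ]) (∁ ⁅ i ⁆)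
    deleted i (_ , H′ , e , image , PH′) = _ , H′ , g , image′ , PH′
      where
      e∈S-y : ∀ a → map e a ∈ S - enum S i
      e∈S-y a = Equivalence.from (image (map e a)) (a , refl)

      g : Embedding H′ (H [ S ])
      g = factorEmbedding (enumEmbedding H S) e λ a → enum-surjective S (p─q⊆p S _ (e∈S-y a))

      enum∘g : ∀ a → enum S (map g a) ≡ map e a
      enum∘g a = proj₂ (enum-surjective S (p─q⊆p S _ (e∈S-y a)))

      image′ : ImageIs g (∁ ⁅ i ⁆)
      image′ j = mk⇔ to from
        where
        to : j ∈ ∁ ⁅ i ⁆ → ∃[ a ] map g a ≡ j
        to j∉⁅i⁆ with Equivalence.to (image (enum S j))
                        (x∈p∧x≢y⇒x∈p-y (enum-∈ S j) (x∉⁅y⁆⇒x≢y (x∈∁p⇒x∉p j∉⁅i⁆) ∘ enum-injective S))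
        ... | a , ea≡ = a , enum-injective S (trans (enum∘g a) ea≡)
        from : ∃[ a ] map g a ≡ j → j ∈ ∁ ⁅ i ⁆
        from (a , refl) = x∉p⇒x∈∁p λ ga∈⁅i⁆ → x∉p-x S (enum S i)
          (subst (_∈ S - enum S i) (trans (sym (enum∘g a)) (cong (enum S) (x∈⁅y⁆⇒x≡y i ga∈⁅i⁆)))
                 (e∈S-y a))

  CriticalThrough : ∀ {m} → Digraph m → Subset m → Fin m → Set
  CriticalThrough H S x = ∃[ S′ ] S′ ⊆ S × x ∈ S′ × Critical P (H [ S′ ])

  ¬¬-criticalThrough : ∀ {m} {H : Digraph m} {S x} → x ∈ S →
                       ¬ InducedIn P H S → InducedIn P H (S - x) → ¬ ¬ CriticalThrough H S x
  ¬¬-criticalThrough {m} {H} {S} {x} = go (⊂-wellFounded S)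
    where
    go : ∀ {S} → Acc _⊂_ S → x ∈ S →
         ¬ InducedIn P H S → InducedIn P H (S - x) → ¬ ¬ CriticalThrough H S x
    go {S} (acc smaller) x∈S ¬PS PS-x none = ¬¬-∀⊎∃¬ (λ i → InducedIn P H (S - enum S i)) λ
      { (inj₁ PS-y)        → none (S , id , x∈S , critical[] ¬PS PS-y)
      ; (inj₂ (i , ¬PS-y)) → shrink i ¬PS-y none
      }
      where
      shrink : ∀ i → ¬ InducedIn P H (S - enum S i) → ¬ ¬ CriticalThrough H S x
      shrink i ¬PS-y = ¬¬-map widen
        (go (smaller (x∈p⇒p-x⊂p y∈S)) (x∈p∧x≢y⇒x∈p-y x∈S x≢y) ¬PS-y (InducedIn-⊆ S-y-x⊆S-x PS-x))
        where
        y : Fin m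
        y = enum S i
        y∈S : y ∈ S
        y∈S = enum-∈ S i
        x≢y : x ≢ y
        x≢y refl = ¬PS-y PS-x
        S-y-x⊆S-x : S - y - x ⊆ S - x
        S-y-x⊆S-x z∈ = p─q⊆p (S - x) _ (subst (_ ∈_) (p─x─y≡p─y─x S y x) z∈)
        widen : CriticalThrough H (S - y) x → CriticalThrough H S x
        widen (S′ , S′⊆S-y , x∈S′ , critical) = S′ , ⊆-trans S′⊆S-y (p─q⊆p S _) , x∈S′ , critical

  module _ {k} (δ⁺≥k : ∀ {n} (D : Digraph n) → Critical P D → ∀ v → k ≤ outdeg D v) where

    k≤outdegIn : ∀ {m} {H : Digraph m} {S x} → x ∈ S → ¬ InducedIn P H S → InducedIn P H (S - x) →
                 k ≤ outdegIn H S x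
    k≤outdegIn {H = H} {S} {x} x∈S ¬PS PS-x =
      decidable-stable (k ≤? outdegIn H S x) (¬¬-map bound (¬¬-criticalThrough x∈S ¬PS PS-x))
      where
      bound : CriticalThrough H S x → k ≤ outdegIn H S x
      bound (S′ , S′⊆S , x∈S′ , critical) with enum-surjective S′ x∈S′
      ... | i , refl = begin
        k                         ≤⟨ δ⁺≥k (H [ S′ ]) critical i ⟩
        outdeg (H [ S′ ]) i       ≤⟨ outdeg[]≤outdegIn H S′ i ⟩
        outdegIn H S′ (enum S′ i) ≤⟨ outdegIn-mono H S′⊆S ⟩
        outdegIn H S (enum S′ i)  ∎
        where open ≤-Reasoning

module _ {n m} {D : Digraph n} {H : Digraph m} (C : Cover D H) where

  part : Fin m → Fin n
  part y = proj₁ (covers C y)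

  ∈-part : ∀ y → y ∈ X C (part y)
  ∈-part y = proj₂ (covers C y)

  arc-projects : ∀ {u w x y} → u ≢ w → x ∈ X C u → y ∈ X C w →
                 arc H x y ≡ true → arc D u w ≡ true
  arc-projects {u} {w} {x} {y} u≢w x∈Xu y∈Xw xy with arc D u w in uw
  ... | true  = refl
  ... | false with () ← trans (sym xy) (noArcs C u w u≢w uw x y x∈Xu y∈Xw)

  part-injectiveOn : ∀ {T y y′} → PartialTransversal C T →
                     y ∈ T → y′ ∈ T → part y ≡ part y′ → y ≡ y′
  part-injectiveOn {T} {y} {y′} pt y∈T y′∈T py≡py′ = ∣p∣≤1⇒≡ (pt (part y))
    (x∈p∩q⁺ (y∈T , ∈-part y)) (x∈p∩q⁺ (y′∈T , subst (λ u → y′ ∈ X C u) (sym py≡py′) (∈-part y′)))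

  ∉dom : ∀ {T v} → DomAllBut C T v → ¬ InDom C T v
  ∉dom {v = v} dom v∈dom = Equivalence.to (dom v) v∈dom refl

  transversal-∪⁅⁆ : ∀ {T v x} → PartialTransversal C T → DomAllBut C T v → x ∈ X C v →
                    Transversal C (T ∪ ⁅ x ⁆)
  transversal-∪⁅⁆ {T} {v} {x} pt dom x∈Xv u with u ≟ v
  ... | yes refl = ∣p∣≡1 (x∈p∩q⁺ (x∈p∪q⁺ (inj₂ (x∈⁅x⁆ x)) , x∈Xv)) ⊆⁅x⁆ (≤-reflexive (∣⁅x⁆∣≡1 x))
    where
    ⊆⁅x⁆ : (T ∪ ⁅ x ⁆) ∩ X C v ⊆ ⁅ x ⁆
    ⊆⁅x⁆ z∈ with x∈p∩q⁻ (T ∪ ⁅ x ⁆) _ z∈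
    ... | z∈T∪x , z∈Xv with ∈-∪⁅⁆⁻ T z∈T∪x
    ...   | inj₁ z∈T  = contradiction (_ , x∈p∩q⁺ (z∈T , z∈Xv)) (∉dom dom)
    ...   | inj₂ refl = x∈⁅x⁆ x
  ... | no u≢v with Equivalence.from (dom u) u≢v
  ...   | z , z∈T∩Xu with x∈p∩q⁻ T _ z∈T∩Xu
  ...     | z∈T , z∈Xu = ∣p∣≡1 (x∈p∩q⁺ (x∈p∪q⁺ (inj₁ z∈T) , z∈Xu)) ⊆T∩Xu (pt u)
    where
    ⊆T∩Xu : (T ∪ ⁅ x ⁆) ∩ X C u ⊆ T ∩ X C u
    ⊆T∩Xu z∈ with x∈p∩q⁻ (T ∪ ⁅ x ⁆) _ z∈
    ... | z∈T∪x , z∈Xu with ∈-∪⁅⁆⁻ T z∈T∪x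
    ...   | inj₁ z∈T  = x∈p∩q⁺ (z∈T , z∈Xu)
    ...   | inj₂ refl = contradiction (disjoint C u v _ z∈Xu x∈Xv) u≢v

  sumOver-outdegIn≤outdeg : ∀ {T v} → PartialTransversal C T → ¬ InDom C T v →
    sumOver (X C v) (λ x → outdegIn H (T ∪ ⁅ x ⁆) x) ≤ outdeg D v
  sumOver-outdegIn≤outdeg {T} {v} pt v∉dom =
    ≤-trans (sumOver-∣∣≤∣unionOver∣ (X C v) N disjointOn)
            (injectiveOn⇒∣p∣≤∣q∣ part part∈N⁺v part-injective)
    where
    N : Fin m → Subset m
    N x = (T ∪ ⁅ x ⁆) ∩ outNbrs H x

    ∈-N⁻ : ∀ {x y} → x ∈ X C v → y ∈ N x → y ∈ T × v ≢ part y × arc D v (part y) ≡ true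
    ∈-N⁻ {x} {y} x∈Xv y∈Nx with ∈-∪⁅⁆∩outNbrs⁻ H T y∈Nx
    ... | y∈T , xy = y∈T , v≢py , arc-projects v≢py x∈Xv (∈-part y) xy
      where
      v≢py : v ≢ part y
      v≢py refl = v∉dom (y , x∈p∩q⁺ (y∈T , ∈-part y))

    disjointOn : DisjointOn (X C v) N
    disjointOn {x} {x′} {y} x∈Xv x′∈Xv y∈Nx y∈Nx′ with ∈-N⁻ x∈Xv y∈Nx
    ... | _ , v≢py , v→py = matchHead C v (part y) v≢py v→py x x′ y x∈Xv x′∈Xv (∈-part y)
      (proj₂ (∈-∪⁅⁆∩outNbrs⁻ H T y∈Nx)) (proj₂ (∈-∪⁅⁆∩outNbrs⁻ H T y∈Nx′))

    ∈-⋃N : ∀ {y} → y ∈ unionOver (X C v) N → ∃[ x ] x ∈ X C v × y ∈ N x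
    ∈-⋃N = ∈-unionOver⁻ (X C v) N

    part∈N⁺v : ∀ {y} → y ∈ unionOver (X C v) N → part y ∈ outNbrs D v
    part∈N⁺v y∈ with ∈-⋃N y∈
    ... | x , x∈Xv , y∈Nx = ∈-outNbrs⁺ D (proj₂ (proj₂ (∈-N⁻ x∈Xv y∈Nx)))

    part-injective : ∀ {y y′} → y ∈ unionOver (X C v) N → y′ ∈ unionOver (X C v) N →
                     part y ≡ part y′ → y ≡ y′
    part-injective y∈ y′∈ with ∈-⋃N y∈ | ∈-⋃N y′∈
    ... | x , x∈Xv , y∈Nx | x′ , x′∈Xv , y′∈Nx′ =
      part-injectiveOn pt (proj₁ (∈-N⁻ x∈Xv y∈Nx)) (proj₁ (∈-N⁻ x′∈Xv y′∈Nx′))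

module CriticalCoverOutdegree (P : Property) (hereditary : Hereditary P)
  {k} (δ⁺≥k : ∀ {n} (D : Digraph n) → Critical P D → ∀ v → k ≤ outdeg D v)
  {n m} {D : Digraph n} {H : Digraph m} (C : Cover D H) (critical : CriticalCover C P) where

  module _ {v T} (pt : PartialTransversal C T) (dom : DomAllBut C T v) (PT : InducedIn P H T) where

    k≤outdegIn-∪⁅⁆ : ∀ {x} → x ∈ X C v → k ≤ outdegIn H (T ∪ ⁅ x ⁆) x
    k≤outdegIn-∪⁅⁆ {x} x∈Xv = k≤outdegIn P hereditary δ⁺≥k (x∈p∪q⁺ (inj₂ (x∈⁅x⁆ x)))
      (λ P[T∪x] → proj₁ critical (_ , transversal-∪⁅⁆ C pt dom x∈Xv , P[T∪x]))
      (InducedIn-⊆ P hereditary T∪x-x⊆T PT)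
      where
      T∪x-x⊆T : T ∪ ⁅ x ⁆ - x ⊆ T
      T∪x-x⊆T {z} z∈ with ∈-∪⁅⁆⁻ T (p─q⊆p _ _ z∈)
      ... | inj₁ z∈T  = z∈T
      ... | inj₂ refl = contradiction z∈ (x∉p-x _ x)

    k*∣Xv∣≤sumOver : k * ∣ X C v ∣ ≤ sumOver (X C v) (λ x → outdegIn H (T ∪ ⁅ x ⁆) x)
    k*∣Xv∣≤sumOver = begin
      k * ∣ X C v ∣                ≡⟨ sumOver-const (X C v) k ⟨
      sumOver (X C v) (λ _ → k)    ≤⟨ sumOver-mono (X C v) k≤outdegIn-∪⁅⁆ ⟩
      sumOver (X C v) (λ x → outdegIn H (T ∪ ⁅ x ⁆) x) ∎
      where open ≤-Reasoning

  outdeg≥ : ∀ v → k * ∣ X C v ∣ ≤ outdeg D v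
  outdeg≥ v with proj₂ critical v
  ... | T , pt , dom , PT =
    ≤-trans (k*∣Xv∣≤sumOver pt dom PT) (sumOver-outdegIn≤outdeg C pt (∉dom C dom))

  outdeg-tight : ∀ v → outdeg D v ≡ k * ∣ X C v ∣ →
    ∀ (T : Subset m) → PartialTransversal C T → DomAllBut C T v → InducedIn P H T →
      (∀ x → x ∈ X C v → outdegIn H (T ∪ ⁅ x ⁆) x ≡ k)
      × (outdeg D v ≡ sumOver (X C v) (λ x → outdegIn H (T ∪ ⁅ x ⁆) x))
  outdeg-tight v d⁺v≡ T pt dom PT =
      (λ x x∈Xv → sym (sumOver-rigid (X C v) (k≤outdegIn-∪⁅⁆ pt dom PT) Σ≤Σk x∈Xv))
    , ≤-antisym (≤-trans (≤-reflexive d⁺v≡) (k*∣Xv∣≤sumOver pt dom PT)) Σ≤d⁺v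
    where
    Σ≤d⁺v : sumOver (X C v) (λ x → outdegIn H (T ∪ ⁅ x ⁆) x) ≤ outdeg D v
    Σ≤d⁺v = sumOver-outdegIn≤outdeg C pt (∉dom C dom)
    Σ≤Σk : sumOver (X C v) (λ x → outdegIn H (T ∪ ⁅ x ⁆) x) ≤ sumOver (X C v) (λ _ → k)
    Σ≤Σk = ≤-trans Σ≤d⁺v (≤-reflexive (trans d⁺v≡ (sym (sumOver-const (X C v) k))))

reverse : ∀ {n} → Digraph n → Digraph n
reverse D = record { arc = λ a b → arc D b a ; loopless = loopless D }

reverseEmbedding : ∀ {m n} {D′ : Digraph m} {D : Digraph n} →
                   Embedding D′ D → Embedding (reverse D′) (reverse D)
reverseEmbedding e = record
  { map = map e ; injective = injective e ; preserves = λ a b → preserves e b a }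

reversed : Property → Property
reversed P D = P (reverse D)

Hereditary-reversed : ∀ {P : Property} → Hereditary P → Hereditary (reversed P)
Hereditary-reversed hereditary D′ D e = hereditary (reverse D′) (reverse D) (reverseEmbedding e)

InducedIn-reverse : ∀ {P : Property} {m} {H : Digraph m} {S} →
                    InducedIn P H S → InducedIn (reversed P) (reverse H) S
InducedIn-reverse (k , H′ , e , image , PH′) = k , reverse H′ , reverseEmbedding e , image , PH′

Critical-reversed : ∀ {P : Property} {n} {D : Digraph n} →
                    Critical (reversed P) D → Critical P (reverse D)
Critical-reversed (¬PD , PD-v) = ¬PD , InducedIn-reverse ∘ PD-v

reverseCover : ∀ {n m} {D : Digraph n} {H : Digraph m} → Cover D H → Cover (reverse D) (reverse H)
reverseCover C = record
  { X         = X C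
  ; disjoint  = disjoint C
  ; covers    = covers C
  ; indep     = λ v x y x∈ y∈ → indep C v y x y∈ x∈
  ; matchTail = λ u v u≢v uv x y y′ x∈ y∈ y′∈ → matchHead C v u (u≢v ∘ sym) uv y y′ x y∈ y′∈ x∈
  ; matchHead = λ u v u≢v uv x x′ y x∈ x′∈ y∈ → matchTail C v u (u≢v ∘ sym) uv y x x′ y∈ x∈ x′∈
  ; noArcs    = λ u v u≢v uv x y x∈ y∈ → noArcs C v u (u≢v ∘ sym) uv y x y∈ x∈
  }

CriticalCover-reverse : ∀ {P : Property} {n m} {D : Digraph n} {H : Digraph m} (C : Cover D H) →
                        CriticalCover C P → CriticalCover (reverseCover C) (reversed P)
CriticalCover-reverse C (noTransversal , partial) =
    (λ (T , transversal , PT) → noTransversal (T , transversal , InducedIn-reverse PT))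
  , λ v → let T , pt , dom , PT = partial v in T , pt , dom , InducedIn-reverse PT

proposition7 : (P : Property) → Reliable P →
    ∀ {n m} (D : Digraph n) (H : Digraph m) (C : Cover D H) →
    CriticalCover C P →
    ∀ (k⁺ k⁻ : ℕ) → IsDPlus P k⁺ → IsDMinus P k⁻ →
      -- (a)
      (∀ v → (k⁺ * ∣ X C v ∣ ≤ outdeg D v) × (k⁻ * ∣ X C v ∣ ≤ indeg D v))
      -- (b)
      × (∀ v → outdeg D v ≡ k⁺ * ∣ X C v ∣ →
          ∀ (T : Subset m) → PartialTransversal C T → DomAllBut C T v →
          InducedIn P H T →
            (∀ x → x ∈ X C v → outdegIn H (T ∪ ⁅ x ⁆) x ≡ k⁺)
            × (outdeg D v ≡ sumOver (X C v) (λ x → outdegIn H (T ∪ ⁅ x ⁆) x)))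
      -- (c)
      × (∀ v → indeg D v ≡ k⁻ * ∣ X C v ∣ →
          ∀ (T : Subset m) → PartialTransversal C T → DomAllBut C T v →
          InducedIn P H T →
            (∀ x → x ∈ X C v → indegIn H (T ∪ ⁅ x ⁆) x ≡ k⁻)
            × (indeg D v ≡ sumOver (X C v) (λ x → indegIn H (T ∪ ⁅ x ⁆) x)))
proposition7 P reliable D H C critical k⁺ k⁻ (_ , δ⁺≥k⁺) (_ , δ⁻≥k⁻) =
    (λ v → Out.outdeg≥ v , In.outdeg≥ v)
  , Out.outdeg-tight
  , λ v d⁻v≡ T pt dom PT → In.outdeg-tight v d⁻v≡ T pt dom (InducedIn-reverse PT)
  where
  open Reliable reliable using (hereditary)
  -- indeg, indegIn and the cover data of (D, H) are definitionally outdeg, outdegIn and the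
  -- cover data of the reversed digraphs.
  module Out = CriticalCoverOutdegree P hereditary δ⁺≥k⁺ C critical
  module In  = CriticalCoverOutdegree (reversed P) (Hereditary-reversed hereditary)
                 (λ D′ → δ⁻≥k⁻ (reverse D′) ∘ Critical-reversed)
                 (reverseCover C) (CriticalCover-reverse C critical)
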